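{- Let $G$ be a finite group. For all families of partitions $\Lambda,\Delta,\Gamma\in\mathcal{P}^{G_\star}$, if the structure coefficient $k^\Gamma_{\Lambda\Delta}$ is nonzero then $|\Gamma|\leq|\Lambda|+|\Delta|$. Equivalently, in the algebra $\mathcal{A}^G_\infty$, the product $\mathbf{C}_{\Lambda;\infty}\mathbf{C}_{\Delta;\infty}$ is a linear combination of the $\mathbf{C}_{\Gamma;\infty}$ with $|\Gamma|\leq|\Lambda|+|\Delta|$, i.e. the function $\mathrm{Fil}(\mathbf{C}_{\Lambda;\infty})=|\Lambda|$ defines a filtration on $\mathcal{A}^G_\infty$.
   Context: $G_\star$ is the set of conjugacy classes of $G$. $\mathcal{P}^{G_\star}$ is the set of families $\Lambda=(\Lambda(c))_{c\in G_\star}$ of partitions, with $|\Lambda|=\sum_c|\Lambda(c)|$ (sum of sizes). A $G$-partial permutation of $\mathbb{N}=\{1,2,\dots\}$ is $(g;(d,\omega))$ where $d\subset\mathbb{N}$ is finite, $\omega:d\to d$ is a bijection, and $g=(g_i)_{i\in d}$ with $g_i\in G$. Product: $(g;(d_1,\omega_1))\cdot(h;(d_2,\omega_2))=(f;(d_1\cup d_2,\widetilde{\omega}_1\widetilde{\omega}_2))$, where $\widetilde{\omega}_j$ extends $\omega_j$ to $d_1\cup d_2$ by the identity, $\widetilde g,\widetilde h$ extend $g,h$ to $d_1\cup d_2$ by $1_G$, the composition $\widetilde{\omega}_1\widetilde{\omega}_2$ applies $\widetilde\omega_1$ first, and $f_i=\widetilde{g}_{\widetilde{\omega}_2^{ -1}(i)}\widetilde{h}_i$.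 For a cycle $(i_1,\dots,i_r)$ of $\omega$ the cycle product is $g_{i_r}\cdots g_{i_1}$ (its conjugacy class is well defined); the type of $(g;(d,\omega))$ is the family $(\rho(c))_{c\in G_\star}$ where $\rho(c)$ has $m_i(\rho(c))$ parts equal to $i$, the number of cycles of $\omega$ of length $i$ whose cycle product lies in $c$. $C_{\Lambda;\infty}$ is the set of $G$-partial permutations of $\mathbb{N}$ of type $\Lambda$ and $\mathbf{C}_{\Lambda;\infty}$ its formal sum; $\mathcal{A}^G_\infty$ is the algebra of (possibly infinite) linear combinations of the $\mathbf{C}_{\Lambda;\infty}$ (the invariants under conjugation by $G\wr\mathcal{S}_\infty$ in the projective limit of the semigroup algebras of $G$-partial permutations of $[n]$). The structure coefficients are defined by $\mathbf{C}_{\Lambda;\infty}\mathbf{C}_{\Delta;\infty}=\sum_\Gamma k^\Gamma_{\Lambda\Delta}\mathbf{C}_{\Gamma;\infty}$; concretely, $k^\Gamma_{\Lambda\Delta}$ is the number of pairs $(x,y)\in C_{\Lambda;\infty}\times C_{\Delta;\infty}$ with $x\cdot y=z$ for a fixed $z\in C_{\Gamma;\infty}$ (independent of the choice of $z$). -}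

module Defs where

open import Level using (0ℓ)
open import Algebra.Bundles using (Group)
open import Data.Nat using (ℕ; zero; suc; _+_; _≤_; _<_; _≥_; _≟_; _≤ᵇ_)
open import Data.Fin using (Fin)
import Data.Fin as Fin
open import Data.Nat.ListAction using (sum)
open import Data.List using (List; []; _∷_; map; length; filter; allFin; _++_)
open import Data.List.Relation.Unary.All using (All)
open import Data.List.Relation.Unary.Linked using (Linked)
open import Data.List.Relation.Unary.Unique.Propositional using (Unique)
open import Data.List.Membership.Propositional using (_∈_)
open import Data.List.Membership.DecPropositional _≟_ using (_∈?_)
open import Data.Product using (∃; _×_; _,_)
open import Data.Bool using (Bool; true; false; if_then_else_; _∧_; not)
open import Relation.Nullary using (¬?)
open import Relation.Nullary.Decidable using (⌊_⌋)
open import Relation.Binary.PropositionalEquality using (_≡_)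
open import Function.Bundles using (_⇔_)

record Partition : Set where
  field
    parts         : List ℕ
    positive      : All (λ p → 0 < p) parts
    nonincreasing : Linked _≥_ parts
open Partition public

size : Partition → ℕ
size ρ = sum (parts ρ)

countB : {A : Set} → (A → Bool) → List A → ℕ
countB p [] = 0
countB p (a ∷ as) = if p a then suc (countB p as) else countB p as

mult : ℕ → Partition → ℕ
mult i ρ = countB (λ p → ⌊ i ≟ p ⌋) (parts ρ)

record IsFiniteGroup (G : Group 0ℓ 0ℓ) : Set where
  open Group G
  field
    card      : ℕ
    enum      : Fin card → Carrier
    enum-surj : ∀ g → ∃ λ j → enum j ≈ g

-- A presentation of the set G⋆ of conjugacy classes: G⋆ is indexed by
-- Fin numClasses, and cl g is the class of g.
record ConjClasses (G : Group 0ℓ 0ℓ) : Set where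
  open Group G
  field
    numClasses : ℕ
    cl         : Carrier → Fin numClasses
    cl-surj    : ∀ c → ∃ λ g → cl g ≡ c
    cl-conj    : ∀ g h → (cl g ≡ cl h) ⇔ (∃ λ u → h ≈ (u ∙ g) ∙ u ⁻¹)
open ConjClasses public

Family : {G : Group 0ℓ 0ℓ} → ConjClasses G → Set
Family C = Fin (numClasses C) → Partition

famSize : {G : Group 0ℓ 0ℓ} (C : ConjClasses G) → Family C → ℕ
famSize C Λ = sum (map (λ c → size (Λ c)) (allFin (numClasses C)))

record GPartialPerm (G : Group 0ℓ 0ℓ) : Set where
  open Group G
  field
    dom : List ℕ
    ω   : ℕ → ℕ           -- only its values on d matter
    lab : ℕ → Carrier     -- g_i, only its values on d matter
open GPartialPerm public

module _ {G : Group 0ℓ 0ℓ} where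
  open Group G

  record Valid (x : GPartialPerm G) : Set where
    field
      positive : All (λ i → 0 < i) (dom x)
      unique   : Unique (dom x)
      into     : ∀ {i} → i ∈ dom x → ω x i ∈ dom x
      inj      : ∀ {i j} → i ∈ dom x → j ∈ dom x → ω x i ≡ ω x j → i ≡ j
      onto     : ∀ {j} → j ∈ dom x → ∃ λ i → i ∈ dom x × ω x i ≡ j

  ωext : GPartialPerm G → ℕ → ℕ
  ωext x i = if ⌊ i ∈? dom x ⌋ then ω x i else i

  gext : GPartialPerm G → ℕ → Carrier
  gext x i = if ⌊ i ∈? dom x ⌋ then lab x i else ε

  findPre : (ℕ → ℕ) → ℕ → List ℕ → ℕ → ℕ
  findPre f i [] d = d
  findPre f i (j ∷ js) d = if ⌊ f j ≟ i ⌋ then j else findPre f i js d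

  ωext⁻¹ : GPartialPerm G → ℕ → ℕ
  ωext⁻¹ x i = if ⌊ i ∈? dom x ⌋ then findPre (ω x) i (dom x) i else i

  -- Product (g;(d1,ω1))·(h;(d2,ω2)) = (f;(d1∪d2, ω̃1ω̃2)), ω̃1 applied first,
  -- f_i = g̃_{ω̃2⁻¹(i)} h̃_i.
  mul : GPartialPerm G → GPartialPerm G → GPartialPerm G
  mul x y = record
    { dom = dom x ++ filter (λ i → ¬? (i ∈? dom x)) (dom y)
    ; ω   = λ i → ωext y (ωext x i)
    ; lab = λ i → gext x (ωext⁻¹ y i) ∙ gext y i
    }

  iter : (ℕ → ℕ) → ℕ → ℕ → ℕ
  iter f zero i = i
  iter f (suc r) i = f (iter f r i)

  -- least r ∈ {start, ..., start+fuel-1} with f^r(j) = j (0 if none)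
  firstReturn : (ℕ → ℕ) → ℕ → ℕ → ℕ → ℕ
  firstReturn f j zero r = 0
  firstReturn f j (suc fuel) r =
    if ⌊ iter f r j ≟ j ⌋ then r else firstReturn f j fuel (suc r)

  orbLen : GPartialPerm G → ℕ → ℕ
  orbLen x j = firstReturn (ωext x) j (length (dom x)) 1

  -- cycle product of the cycle (i_1,...,i_r) with i_1 = j, i_{k+1} = ω(i_k):
  -- g_{i_r} ⋯ g_{i_1}
  cycProd : GPartialPerm G → ℕ → ℕ → Carrier
  cycProd x zero j = ε
  cycProd x (suc k) j = gext x (iter (ωext x) k j) ∙ cycProd x k j

  allBelow : ℕ → (ℕ → Bool) → Bool
  allBelow zero p = true
  allBelow (suc n) p = p n ∧ allBelow n p

  -- j is the smallest element of its cycle (canonical representative)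
  isCycleMin : GPartialPerm G → ℕ → Bool
  isCycleMin x j = allBelow (orbLen x j) (λ k → j ≤ᵇ iter (ωext x) k j)

  cycleCount : (C : ConjClasses G) → GPartialPerm G → Fin (numClasses C) → ℕ → ℕ
  cycleCount C x c i = countB
    (λ j → ⌊ orbLen x j ≟ i ⌋ ∧ isCycleMin x j
           ∧ ⌊ cl C (cycProd x i j) Fin.≟ c ⌋)
    (dom x)

  HasType : (C : ConjClasses G) → GPartialPerm G → Family C → Set
  HasType C x Λ = ∀ (c : Fin (numClasses C)) (i : ℕ) → cycleCount C x c i ≡ mult i (Λ c)

-- A G-partial permutation of type Λ has |Λ| = |d|: the parts of the partitions Λ(c) are
-- the lengths of the cycles of ω, and the cycles partition d. The product x · y lives on
-- d₁ ∪ d₂, so |Γ| = |d₁ ∪ d₂| ≤ |d₁| + |d₂| = |Λ| + |Δ|.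
module Submission where

open import Defs
open import Level using (0ℓ)
open import Algebra.Bundles using (Group)
open import Algebra.Properties.CommutativeSemigroup using (interchange)
open import Data.Bool using (Bool; true; false; if_then_else_; _∧_; T)
open import Data.Bool.Properties using (T-∧; if-∧)
open import Data.Empty using (⊥-elim)
open import Data.Fin using (Fin)
import Data.Fin as Fin
open import Data.List using (List; []; _∷_; map; length; allFin; concatMap; applyDownFrom; downFrom)
open import Data.List.Extrema.Nat using (min; min≤xs; argmin-all)
open import Data.List.Membership.Propositional using (_∈_; _∉_; find; lose)
open import Data.List.Membership.Propositional.Properties
  using (∈-applyDownFrom⁺; ∈-applyDownFrom⁻; ∈-downFrom⁺; ∈-allFin; ∈-concatMap⁺; ∈-concatMap⁻;
         ∈-++⁺ˡ; ∈-++⁺ʳ; ∈-++⁻; ∈-filter⁺; ∈-filter⁻)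
open import Data.List.Properties
  using (length-++; length-filter; length-applyDownFrom; map-cong; map-cong-local; map-id)
open import Data.List.Relation.Binary.Subset.Propositional using (_⊆_)
open import Data.List.Relation.Unary.All as All using (All; []; _∷_)
open import Data.List.Relation.Unary.AllPairs using ([]; _∷_)
open import Data.List.Relation.Unary.Any using (here; there)
open import Data.List.Relation.Unary.Unique.Propositional using (Unique)
open import Data.List.Relation.Unary.Unique.Propositional.Properties
  using (++⁺; filter⁺; applyDownFrom⁺₁; downFrom⁺; allFin⁺)
open import Data.Nat using (ℕ; zero; suc; _+_; _*_; _∸_; _≤_; _<_; _≤ᵇ_; z≤n; s≤s; z<s; _≟_)
open import Data.Nat.ListAction using (sum)
open import Data.List.Membership.DecPropositional _≟_ using (_∈?_)
open import Data.Nat.Properties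
open import Data.Product using (∃; _×_; _,_; proj₁; proj₂)
open import Data.Sum using (_⊎_; inj₁; inj₂; swap)
open import Data.Unit using (tt)
open import Function using (id; _∘_)
open import Function.Bundles using (Equivalence)
open import Relation.Binary.PropositionalEquality
open import Relation.Nullary using (¬_; Dec; yes; no; ¬?; contradiction)
open import Relation.Nullary.Decidable using (⌊_⌋; toWitness; fromWitness)
open import Relation.Unary using (Pred; Decidable)

private
  variable
    A B : Set

open Equivalence using (to; from)

remove-∈ : {x : A} {ys : List A} → x ∈ ys →
  ∃ λ zs → length ys ≡ suc (length zs) × (∀ {v} → v ∈ ys → v ≢ x → v ∈ zs)
remove-∈ (here refl) = _ , refl , λ { (here refl) v≢v → contradiction refl v≢v ; (there v∈) _ → v∈ }
remove-∈ {ys = y ∷ ys} (there x∈) =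
  let zs , len≡ , keep = remove-∈ x∈
  in y ∷ zs , cong suc len≡ , λ { (here refl) _ → here refl ; (there v∈) v≢x → there (keep v∈ v≢x) }

Unique-⊆⇒length≤ : {xs ys : List A} → Unique xs → xs ⊆ ys → length xs ≤ length ys
Unique-⊆⇒length≤ {xs = []}     _             _     = z≤n
Unique-⊆⇒length≤ {xs = x ∷ xs} (x∉xs ∷ xs!) xs⊆ys =
  let zs , len≡ , keep = remove-∈ (xs⊆ys (here refl))
  in subst (suc (length xs) ≤_) (sym len≡)
       (s≤s (Unique-⊆⇒length≤ xs! λ v∈ → keep (xs⊆ys (there v∈)) (All.lookup x∉xs v∈ ∘ sym)))

sum-map-+ : (g h : A → ℕ) (xs : List A) →
  sum (map (λ a → g a + h a) xs) ≡ sum (map g xs) + sum (map h xs)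
sum-map-+ g h []       = refl
sum-map-+ g h (a ∷ xs) = begin
  (g a + h a) + sum (map (λ a → g a + h a) xs)     ≡⟨ cong (g a + h a +_) (sum-map-+ g h xs) ⟩
  (g a + h a) + (sum (map g xs) + sum (map h xs))  ≡⟨ interchange +-commutativeSemigroup (g a) (h a) _ _ ⟩
  (g a + sum (map g xs)) + (h a + sum (map h xs))  ∎
  where open ≡-Reasoning

sum-map-zero : {g : A → ℕ} (xs : List A) → (∀ {a} → a ∈ xs → g a ≡ 0) → sum (map g xs) ≡ 0
sum-map-zero []       _   = refl
sum-map-zero (a ∷ xs) g≡0 = cong₂ _+_ (g≡0 (here refl)) (sum-map-zero xs (g≡0 ∘ there))

sum-map-swap : (g : A → B → ℕ) (xs : List A) (ys : List B) →
  sum (map (λ a → sum (map (g a) ys)) xs) ≡ sum (map (λ b → sum (map (λ a → g a b) xs)) ys)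
sum-map-swap g []       ys = sym (sum-map-zero ys λ _ → refl)
sum-map-swap g (a ∷ xs) ys = begin
  sum (map (g a) ys) + sum (map (λ a → sum (map (g a) ys)) xs)
    ≡⟨ cong (sum (map (g a) ys) +_) (sum-map-swap g xs ys) ⟩
  sum (map (g a) ys) + sum (map (λ b → sum (map (λ a → g a b) xs)) ys)
    ≡⟨ sum-map-+ (g a) _ ys ⟨
  sum (map (λ b → g a b + sum (map (λ a → g a b) xs)) ys) ∎
  where open ≡-Reasoning

sum-map-if-singleton : {P : Pred A 0ℓ} (P? : Decidable P) (h : A → ℕ) {p : A} {xs : List A} →
  Unique xs → p ∈ xs → P p → (∀ {a} → P a → a ≡ p) →
  sum (map (λ a → if ⌊ P? a ⌋ then h a else 0) xs) ≡ h p
sum-map-if-singleton P? h {p} {a ∷ xs} (a∉xs ∷ xs!) p∈ Pp P⇒≡p with P? a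
... | yes Pa = trans (cong₂ _+_ (cong h (P⇒≡p Pa)) (sum-map-zero xs only-a)) (+-identityʳ (h p))
  where
  only-a : ∀ {b} → b ∈ xs → (if ⌊ P? b ⌋ then h b else 0) ≡ 0
  only-a {b} b∈ with P? b
  ... | yes Pb = contradiction (trans (P⇒≡p Pa) (sym (P⇒≡p Pb))) (All.lookup a∉xs b∈)
  ... | no  _  = refl
... | no ¬Pa with p∈
...   | here refl   = contradiction Pp ¬Pa
...   | there p∈xs = sum-map-if-singleton P? h xs! p∈xs Pp P⇒≡p

countB-∈ : {p : A → Bool} {a : A} {xs : List A} → a ∈ xs → T (p a) → 0 < countB p xs
countB-∈ {p = p} {xs = b ∷ xs} a∈ pa with p b in pb | a∈
... | true  | _          = z<s
... | false | here refl  = ⊥-elim (subst T pb pa)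
... | false | there a∈xs = countB-∈ a∈xs pa

countB-positive : {p : A → Bool} (xs : List A) → 0 < countB p xs → ∃ λ a → T (p a)
countB-positive {p = p} (a ∷ xs) pos with p a in pa
... | true  = a , subst T (sym pa) tt
... | false = countB-positive xs pos

*-countB : (w : ℕ) (p : A → Bool) (xs : List A) →
  w * countB p xs ≡ sum (map (λ a → if p a then w else 0) xs)
*-countB w p []       = *-zeroʳ w
*-countB w p (a ∷ xs) with p a
... | true  = trans (*-suc w (countB p xs)) (cong (w +_) (*-countB w p xs))
... | false = *-countB w p xs

sum-*-countB : (w : B → ℕ) (P : B → A → Bool) (is : List B) (xs : List A) →
  sum (map (λ i → w i * countB (P i) xs) is)
    ≡ sum (map (λ a → sum (map (λ i → if P i a then w i else 0) is)) xs)
sum-*-countB w P is xs =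
  trans (cong sum (map-cong (λ i → *-countB (w i) (P i) xs) is)) (sum-map-swap _ is xs)

size≡sum-mult : (ρ : Partition) (N : ℕ) → All (_< N) (parts ρ) →
  size ρ ≡ sum (map (λ i → i * mult i ρ) (downFrom N))
size≡sum-mult ρ N bounded = begin
  sum (parts ρ)
    ≡⟨ cong sum (map-id (parts ρ)) ⟨
  sum (map id (parts ρ))
    ≡⟨ cong sum (map-cong-local (All.map as-sum bounded)) ⟩
  sum (map (λ q → sum (map (λ i → if ⌊ i ≟ q ⌋ then i else 0) (downFrom N))) (parts ρ))
    ≡⟨ sum-*-countB id (λ i q → ⌊ i ≟ q ⌋) (downFrom N) (parts ρ) ⟨
  sum (map (λ i → i * mult i ρ) (downFrom N)) ∎
  where
  open ≡-Reasoning
  as-sum : ∀ {q} → q < N → q ≡ sum (map (λ i → if ⌊ i ≟ q ⌋ then i else 0) (downFrom N))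
  as-sum q<N = sym (sum-map-if-singleton (_≟ _) id (downFrom⁺ N) (∈-downFrom⁺ q<N) refl id)

-- `iter`, `firstReturn` and `allBelow` carry an unused implicit group, fixed here as a parameter.
module Iteration (G : Group 0ℓ 0ℓ) (f : ℕ → ℕ) where

  f^ : ℕ → ℕ → ℕ
  f^ = iter {G = G} f

  iter-+ : ∀ a b j → f^ a (f^ b j) ≡ f^ (a + b) j
  iter-+ zero    b j = refl
  iter-+ (suc a) b j = cong f (iter-+ a b j)

  NoReturnBetween : ℕ → ℕ → ℕ → Set
  NoReturnBetween j a b = ∀ s → a ≤ s → s < b → f^ s j ≢ j

  record IsPeriod (j p : ℕ) : Set where
    field
      positive : 0 < p
      returns  : f^ p j ≡ j
      first    : NoReturnBetween j 1 p

  iter-mod : ∀ {j p} → 0 < p → f^ p j ≡ j → ∀ t → ∃ λ s → s < p × f^ t j ≡ f^ s j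
  iter-mod pos ret zero    = 0 , pos , refl
  iter-mod pos ret (suc t) with iter-mod pos ret t
  ... | s , s<p , t~s with m≤n⇒m<n∨m≡n s<p
  ...   | inj₁ 1+s<p = suc s , 1+s<p , cong f t~s
  ...   | inj₂ refl  = 0 , pos , trans (cong f t~s) ret

  data FirstReturn (j fuel r : ℕ) : ℕ → Set where
    none : NoReturnBetween j r (r + fuel) → FirstReturn j fuel r 0
    some : ∀ {v} → r ≤ v → v < r + fuel → f^ v j ≡ j → NoReturnBetween j r v →
           FirstReturn j fuel r v

  NoReturnBetween-extend : ∀ {j r b} → f^ r j ≢ j → NoReturnBetween j (suc r) b →
                           NoReturnBetween j r b
  NoReturnBetween-extend ¬ret later s r≤s s<b with m≤n⇒m<n∨m≡n r≤s
  ... | inj₁ r<s  = later s r<s s<b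
  ... | inj₂ refl = ¬ret

  firstReturn-spec : ∀ j fuel r → FirstReturn j fuel r (firstReturn {G = G} f j fuel r)
  firstReturn-spec j zero       r = none λ s r≤s s<r+0 _ → <⇒≱ (subst (s <_) (+-identityʳ r) s<r+0) r≤s
  firstReturn-spec j (suc fuel) r with iter {G = G} f r j ≟ j
  ... | yes ret = some ≤-refl (m<m+n r z<s) ret λ s r≤s s<r _ → <⇒≱ s<r r≤s
  ... | no ¬ret with firstReturn {G = G} f j fuel (suc r) | firstReturn-spec j fuel (suc r)
  ...   | .0 | none later =
    none (NoReturnBetween-extend ¬ret (subst (NoReturnBetween j (suc r)) (sym (+-suc r fuel)) later))
  ...   | v  | some r<v v<end ret earlier =
    some (<⇒≤ r<v) (subst (v <_) (sym (+-suc r fuel)) v<end) ret (NoReturnBetween-extend ¬ret earlier)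

  firstReturn≤fuel : ∀ j fuel → firstReturn {G = G} f j fuel 1 ≤ fuel
  firstReturn≤fuel j fuel with firstReturn {G = G} f j fuel 1 | firstReturn-spec j fuel 1
  ... | .0 | none _               = z≤n
  ... | v  | some _ v<1+fuel _ _ = m<1+n⇒m≤n v<1+fuel

  T-allBelow⁻ : ∀ N p → T (allBelow {G = G} N p) → ∀ {k} → k < N → T (p k)
  T-allBelow⁻ (suc N) p all {k} k<1+N with to T-∧ all | m<1+n⇒m<n∨m≡n k<1+N
  ... | _  , rest | inj₁ k<N = T-allBelow⁻ N p rest k<N
  ... | pN , _    | inj₂ refl = pN

  T-allBelow⁺ : ∀ N p → (∀ {k} → k < N → T (p k)) → T (allBelow {G = G} N p)
  T-allBelow⁺ zero    p _   = tt
  T-allBelow⁺ (suc N) p all = from T-∧ (all (n<1+n N) , T-allBelow⁺ N p (all ∘ m<n⇒m<1+n))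

  module _ (f-injective : ∀ {a b} → f a ≡ f b → a ≡ b) where

    iter-injective : ∀ r {a b} → f^ r a ≡ f^ r b → a ≡ b
    iter-injective zero    eq = eq
    iter-injective (suc r) eq = iter-injective r (f-injective eq)

    iterates-distinct : ∀ {j p} → NoReturnBetween j 1 p →
                        ∀ {i k} → k < i → i < p → f^ i j ≢ f^ k j
    iterates-distinct {j} no-return {i} {k} k<i i<p eq =
      no-return (i ∸ k) (m<n⇒0<n∸m k<i) (≤-<-trans (m∸n≤m i k) i<p) (iter-injective k (begin
        f^ k (f^ (i ∸ k) j)  ≡⟨ iter-+ k (i ∸ k) j ⟩
        f^ (k + (i ∸ k)) j   ≡⟨ cong (λ t → f^ t j) (m+[n∸m]≡n (<⇒≤ k<i)) ⟩
        f^ i j               ≡⟨ eq ⟩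
        f^ k j               ∎))
      where open ≡-Reasoning

-- The cycles of an injective map that preserves a finite set

record Permutes (f : ℕ → ℕ) (D : List ℕ) : Set where
  field
    injective : ∀ {a b} → f a ≡ f b → a ≡ b
    unique    : Unique D
    closed    : ∀ {i} → i ∈ D → f i ∈ D

module Cycles (G : Group 0ℓ 0ℓ) {f : ℕ → ℕ} {D : List ℕ} (perm : Permutes f D) where
  open Iteration G f
  open IsPeriod
  open Permutes perm

  period : ℕ → ℕ
  period j = firstReturn {G = G} f j (length D) 1

  orbit : ℕ → List ℕ
  orbit j = applyDownFrom (λ r → f^ r j) (period j)

  isLeastInOrbit : ℕ → Bool
  isLeastInOrbit j = allBelow {G = G} (period j) (λ k → j ≤ᵇ f^ k j)

  cycleFrom : ℕ → List ℕ
  cycleFrom j = if isLeastInOrbit j then orbit j else []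

  iter-closed : ∀ r {j} → j ∈ D → f^ r j ∈ D
  iter-closed zero    j∈ = j∈
  iter-closed (suc r) j∈ = closed (iter-closed r j∈)

  -- Were there no return within |D| steps, the first |D| + 1 iterates would be distinct
  -- elements of D.
  period-isPeriod : ∀ {j} → j ∈ D → IsPeriod j (period j)
  period-isPeriod {j} j∈ with firstReturn {G = G} f j (length D) 1 | firstReturn-spec j (length D) 1
  ... | .0 | none never = contradiction
    (subst (_≤ length D) (length-applyDownFrom (λ r → f^ r j) (suc (length D)))
      (Unique-⊆⇒length≤ (applyDownFrom⁺₁ _ _ (iterates-distinct injective never)) iterates∈D))
    (<-irrefl refl)
    where
    iterates∈D : applyDownFrom (λ r → f^ r j) (suc (length D)) ⊆ D
    iterates∈D v∈ with ∈-applyDownFrom⁻ (λ r → f^ r j) v∈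
    ... | r , _ , refl = iter-closed r j∈
  ... | v  | some 1≤v _ ret earlier = record { positive = 1≤v ; returns = ret ; first = earlier }

  iter∈orbit : ∀ {j} → j ∈ D → ∀ t → f^ t j ∈ orbit j
  iter∈orbit {j} j∈ t =
    let s , s<p , t~s = iter-mod (positive P) (returns P) t
    in subst (_∈ orbit j) (sym t~s) (∈-applyDownFrom⁺ (λ r → f^ r j) s<p)
    where P = period-isPeriod j∈

  orbit⊆D : ∀ {j} → j ∈ D → orbit j ⊆ D
  orbit⊆D {j} j∈ k∈ with ∈-applyDownFrom⁻ (λ r → f^ r j) k∈
  ... | r , _ , refl = iter-closed r j∈

  orbit-unique : ∀ {j} → j ∈ D → Unique (orbit j)
  orbit-unique j∈ = applyDownFrom⁺₁ _ _ (iterates-distinct injective (first (period-isPeriod j∈)))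

  orbit-sym : ∀ {j k} → j ∈ D → k ∈ orbit j → j ∈ orbit k
  orbit-sym {j} j∈ k∈ with ∈-applyDownFrom⁻ (λ r → f^ r j) k∈
  ... | r , r<p , refl = subst (_∈ orbit (f^ r j)) back (iter∈orbit (iter-closed r j∈) (period j ∸ r))
    where
    open ≡-Reasoning
    back : f^ (period j ∸ r) (f^ r j) ≡ j
    back = begin
      f^ (period j ∸ r) (f^ r j)  ≡⟨ iter-+ (period j ∸ r) r j ⟩
      f^ (period j ∸ r + r) j     ≡⟨ cong (λ t → f^ t j) (m∸n+n≡m (<⇒≤ r<p)) ⟩
      f^ (period j) j             ≡⟨ returns (period-isPeriod j∈) ⟩
      j                           ∎

  orbit-trans : ∀ {j k l} → j ∈ D → k ∈ orbit j → l ∈ orbit k → l ∈ orbit j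
  orbit-trans {j} j∈ k∈ l∈ with ∈-applyDownFrom⁻ (λ r → f^ r j) k∈
  ... | r , _ , refl with ∈-applyDownFrom⁻ (λ s → f^ s (f^ r j)) l∈
  ...   | s , _ , refl = subst (_∈ orbit j) (sym (iter-+ s r j)) (iter∈orbit j∈ (s + r))

  isLeastInOrbit⇒≤ : ∀ {j k} → T (isLeastInOrbit j) → k ∈ orbit j → j ≤ k
  isLeastInOrbit⇒≤ {j} least k∈ with ∈-applyDownFrom⁻ (λ r → f^ r j) k∈
  ... | r , r<p , refl = ≤ᵇ⇒≤ j (f^ r j) (T-allBelow⁻ (period j) _ least r<p)

  ≤⇒isLeastInOrbit : ∀ {j} → (∀ {k} → k ∈ orbit j → j ≤ k) → T (isLeastInOrbit j)
  ≤⇒isLeastInOrbit {j} least =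
    T-allBelow⁺ (period j) _ λ r<p → ≤⇒≤ᵇ (least (∈-applyDownFrom⁺ (λ r → f^ r j) r<p))

  least-unique : ∀ {j j′ v} → j ∈ D → j′ ∈ D → T (isLeastInOrbit j) → T (isLeastInOrbit j′) →
                 v ∈ orbit j → v ∈ orbit j′ → j ≡ j′
  least-unique j∈ j′∈ least least′ v∈ v∈′ = ≤-antisym
    (isLeastInOrbit⇒≤ least  (orbit-trans j∈  v∈  (orbit-sym j′∈ v∈′)))
    (isLeastInOrbit⇒≤ least′ (orbit-trans j′∈ v∈′ (orbit-sym j∈  v∈)))

  least-exists : ∀ {k} → k ∈ D → ∃ λ m → m ∈ D × T (isLeastInOrbit m) × k ∈ orbit m
  least-exists {k} k∈ = m , orbit⊆D k∈ m∈ , ≤⇒isLeastInOrbit m-least , orbit-sym k∈ m∈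
    where
    m = min k (orbit k)
    m∈ : m ∈ orbit k
    m∈ = argmin-all id {P = _∈ orbit k} (iter∈orbit k∈ 0) (All.tabulate id)
    m-least : ∀ {l} → l ∈ orbit m → m ≤ l
    m-least l∈ = All.lookup (min≤xs k (orbit k)) (orbit-trans k∈ m∈ l∈)

  ∈-cycleFrom⁻ : ∀ {j v} → v ∈ cycleFrom j → T (isLeastInOrbit j) × v ∈ orbit j
  ∈-cycleFrom⁻ {j} v∈ with isLeastInOrbit j
  ... | true = tt , v∈
  ∈-cycleFrom⁻ {j} () | false

  ∈-cycleFrom⁺ : ∀ {j v} → T (isLeastInOrbit j) → v ∈ orbit j → v ∈ cycleFrom j
  ∈-cycleFrom⁺ {j} least v∈ with isLeastInOrbit j
  ... | true = v∈

  cycleFrom-unique : ∀ {j} → j ∈ D → Unique (cycleFrom j)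
  cycleFrom-unique {j} j∈ with isLeastInOrbit j
  ... | true  = orbit-unique j∈
  ... | false = []

  length-cycleFrom : ∀ j → length (cycleFrom j) ≡ (if isLeastInOrbit j then period j else 0)
  length-cycleFrom j with isLeastInOrbit j
  ... | true  = length-applyDownFrom _ (period j)
  ... | false = refl

  ∈-cycles⁻ : ∀ {ks v} → v ∈ concatMap cycleFrom ks →
              ∃ λ j → j ∈ ks × T (isLeastInOrbit j) × v ∈ orbit j
  ∈-cycles⁻ v∈ with find (∈-concatMap⁻ cycleFrom v∈)
  ... | j , j∈ , v∈cycle = j , j∈ , ∈-cycleFrom⁻ v∈cycle

  ∈-cycles⁺ : ∀ {ks j v} → j ∈ ks → T (isLeastInOrbit j) → v ∈ orbit j →
              v ∈ concatMap cycleFrom ks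
  ∈-cycles⁺ j∈ least v∈ = ∈-concatMap⁺ cycleFrom (lose j∈ (∈-cycleFrom⁺ least v∈))

  cycles-unique : ∀ {ks} → Unique ks → ks ⊆ D → Unique (concatMap cycleFrom ks)
  cycles-unique {[]}     _             _    = []
  cycles-unique {j ∷ ks} (j∉ks ∷ ks!) ks⊆D =
    ++⁺ (cycleFrom-unique (ks⊆D (here refl))) (cycles-unique ks! (ks⊆D ∘ there)) disjoint
    where
    disjoint : ∀ {v} → ¬ (v ∈ cycleFrom j × v ∈ concatMap cycleFrom ks)
    disjoint (v∈ , v∈ks) =
      let least , v∈orbit = ∈-cycleFrom⁻ v∈
          j′ , j′∈ , least′ , v∈orbit′ = ∈-cycles⁻ v∈ks
      in All.lookup j∉ks j′∈
           (least-unique (ks⊆D (here refl)) (ks⊆D (there j′∈)) least least′ v∈orbit v∈orbit′)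

  length-cycles : ∀ ks →
    length (concatMap cycleFrom ks) ≡ sum (map (λ j → if isLeastInOrbit j then period j else 0) ks)
  length-cycles []       = refl
  length-cycles (j ∷ ks) =
    trans (length-++ (cycleFrom j)) (cong₂ _+_ (length-cycleFrom j) (length-cycles ks))

  sum-periods-of-least : sum (map (λ j → if isLeastInOrbit j then period j else 0) D) ≡ length D
  sum-periods-of-least = trans (sym (length-cycles D)) (≤-antisym
    (Unique-⊆⇒length≤ (cycles-unique unique id) cycles⊆D)
    (Unique-⊆⇒length≤ unique D⊆cycles))
    where
    cycles⊆D : concatMap cycleFrom D ⊆ D
    cycles⊆D v∈ = let j , j∈ , _ , v∈orbit = ∈-cycles⁻ v∈ in orbit⊆D j∈ v∈orbit
    D⊆cycles : D ⊆ concatMap cycleFrom D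
    D⊆cycles k∈ = let m , m∈ , least , k∈orbit = least-exists k∈ in ∈-cycles⁺ m∈ least k∈orbit

-- The size of the type of a G-partial permutation

module _ {G : Group 0ℓ 0ℓ} (C : ConjClasses G) (z : GPartialPerm G) where
  open Iteration G (ωext z) using (firstReturn≤fuel)

  cycleClass : ℕ → Fin (numClasses C)
  cycleClass j = cl C (cycProd z (orbLen z j) j)

  orbLen≤length-dom : ∀ j → orbLen z j ≤ length (dom z)
  orbLen≤length-dom j = firstReturn≤fuel j (length (dom z))

  parts-bounded : (Γ : Family C) → HasType C z Γ → ∀ c → All (_< suc (length (dom z))) (parts (Γ c))
  parts-bounded Γ type c = All.tabulate part<
    where
    part< : ∀ {q} → q ∈ parts (Γ c) → q < suc (length (dom z))
    part< {q} q∈ =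
      let j , t = countB-positive (dom z) (subst (0 <_) (sym (type c q)) (countB-∈ q∈ (fromWitness refl)))
          orbLen≡q = toWitness (proj₁ (to (T-∧ {⌊ orbLen z j ≟ q ⌋}) t))
      in s≤s (subst (_≤ length (dom z)) orbLen≡q (orbLen≤length-dom j))

  size-of-type : (Γ : Family C) → HasType C z Γ → ∀ c →
    size (Γ c) ≡
      sum (map (λ j → if isCycleMin z j ∧ ⌊ cycleClass j Fin.≟ c ⌋ then orbLen z j else 0) (dom z))
  size-of-type Γ type c = begin
    size (Γ c)
      ≡⟨ size≡sum-mult (Γ c) N (parts-bounded Γ type c) ⟩
    sum (map (λ i → i * mult i (Γ c)) (downFrom N))
      ≡⟨ cong sum (map-cong (λ i → cong (i *_) (type c i)) (downFrom N)) ⟨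
    sum (map (λ i → i * cycleCount C z c i) (downFrom N))
      ≡⟨ sum-*-countB id (λ i j → ⌊ orbLen z j ≟ i ⌋ ∧ leastInClass i j) (downFrom N) (dom z) ⟩
    sum (map (λ j → sum (map (ofLength j) (downFrom N))) (dom z))
      ≡⟨ cong sum (map-cong sum-ofLength (dom z)) ⟩
    sum (map (λ j → if leastInClass (orbLen z j) j then orbLen z j else 0) (dom z)) ∎
    where
    open ≡-Reasoning
    N = suc (length (dom z))
    leastInClass : ℕ → ℕ → Bool
    leastInClass i j = isCycleMin z j ∧ ⌊ cl C (cycProd z i j) Fin.≟ c ⌋
    ofLength : ℕ → ℕ → ℕ
    ofLength j i = if ⌊ orbLen z j ≟ i ⌋ ∧ leastInClass i j then i else 0
    sum-ofLength : ∀ j → sum (map (ofLength j) (downFrom N))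
                           ≡ (if leastInClass (orbLen z j) j then orbLen z j else 0)
    sum-ofLength j = trans (cong sum (map-cong (λ i → if-∧ ⌊ orbLen z j ≟ i ⌋) (downFrom N)))
      (sum-map-if-singleton (orbLen z j ≟_) (λ i → if leastInClass i j then i else 0)
        (downFrom⁺ N) (∈-downFrom⁺ (s≤s (orbLen≤length-dom j))) refl sym)

  famSize-of-type : (Γ : Family C) → HasType C z Γ →
    famSize C Γ ≡ sum (map (λ j → if isCycleMin z j then orbLen z j else 0) (dom z))
  famSize-of-type Γ type = begin
    sum (map (λ c → size (Γ c)) (allFin K))
      ≡⟨ cong sum (map-cong (size-of-type Γ type) (allFin K)) ⟩
    sum (map (λ c → sum (map (λ j → contribution j c) (dom z))) (allFin K))
      ≡⟨ sum-map-swap (λ c j → contribution j c) (allFin K) (dom z) ⟩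
    sum (map (λ j → sum (map (contribution j) (allFin K))) (dom z))
      ≡⟨ cong sum (map-cong one-class (dom z)) ⟩
    sum (map (λ j → if isCycleMin z j then orbLen z j else 0) (dom z)) ∎
    where
    open ≡-Reasoning
    K = numClasses C
    contribution : ℕ → Fin K → ℕ
    contribution j c = if isCycleMin z j ∧ ⌊ cycleClass j Fin.≟ c ⌋ then orbLen z j else 0
    one-class : ∀ j → sum (map (contribution j) (allFin K)) ≡ (if isCycleMin z j then orbLen z j else 0)
    one-class j with isCycleMin z j
    ... | true  = sum-map-if-singleton (cycleClass j Fin.≟_) (λ _ → orbLen z j)
                    (allFin⁺ K) (∈-allFin (cycleClass j)) refl sym
    ... | false = sum-map-zero (allFin K) λ _ → refl

  famSize≡length-dom : (Γ : Family C) → Permutes (ωext z) (dom z) → HasType C z Γ →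
                       famSize C Γ ≡ length (dom z)
  famSize≡length-dom Γ perm type = trans (famSize-of-type Γ type) (Cycles.sum-periods-of-least G perm)

-- The product of G-partial permutations

module _ {G : Group 0ℓ 0ℓ} where

  private
    if-yes : {P : Set} (d : Dec P) {a b : ℕ} → P → (if ⌊ d ⌋ then a else b) ≡ a
    if-yes (yes _) _ = refl
    if-yes (no ¬p) p = contradiction p ¬p

    if-no : {P : Set} (d : Dec P) {a b : ℕ} → ¬ P → (if ⌊ d ⌋ then a else b) ≡ b
    if-no (yes p) ¬p = contradiction p ¬p
    if-no (no _)  _  = refl

  ωext-∈ : (x : GPartialPerm G) {i : ℕ} → i ∈ dom x → ωext x i ≡ ω x i
  ωext-∈ x {i} = if-yes (i ∈? dom x)

  ωext-∉ : (x : GPartialPerm G) {i : ℕ} → i ∉ dom x → ωext x i ≡ i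
  ωext-∉ x {i} = if-no (i ∈? dom x)

  Valid⇒Permutes : {x : GPartialPerm G} → Valid x → Permutes (ωext x) (dom x)
  Valid⇒Permutes {x} valid = record { injective = ωext-injective ; unique = unique ; closed = ωext-closed }
    where
    open Valid valid
    ωext-closed : ∀ {i} → i ∈ dom x → ωext x i ∈ dom x
    ωext-closed i∈ = subst (_∈ dom x) (sym (ωext-∈ x i∈)) (into i∈)
    ωext-injective : ∀ {a b} → ωext x a ≡ ωext x b → a ≡ b
    -- The with-abstraction also rewrites ωext x in the type of eq to the chosen branches.
    ωext-injective {a} {b} eq with a ∈? dom x | b ∈? dom x
    ... | yes a∈ | yes b∈ = inj a∈ b∈ eq
    ... | yes a∈ | no b∉  = contradiction (subst (_∈ dom x) eq (into a∈)) b∉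
    ... | no a∉  | yes b∈ = contradiction (subst (_∈ dom x) (sym eq) (into b∈)) a∉
    ... | no a∉  | no b∉  = eq

  ωext-closed-∪ : (x : GPartialPerm G) {ys : List ℕ} → Permutes (ωext x) (dom x) →
                  ∀ {i} → i ∈ dom x ⊎ i ∈ ys → ωext x i ∈ dom x ⊎ ωext x i ∈ ys
  ωext-closed-∪ x px (inj₁ i∈x) = inj₁ (Permutes.closed px i∈x)
  ωext-closed-∪ x px {i} (inj₂ i∈ys) with i ∈? dom x
  ... | yes i∈x = inj₁ (subst (_∈ dom x) (ωext-∈ x i∈x) (Permutes.closed px i∈x))
  ... | no  _   = inj₂ i∈ys

  module _ (x y : GPartialPerm G) where

    private
      ∉x? : Decidable (_∉ dom x)
      ∉x? i = ¬? (i ∈? dom x)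

    ∈-dom-mul⁻ : ∀ {i} → i ∈ dom (mul x y) → i ∈ dom x ⊎ i ∈ dom y
    ∈-dom-mul⁻ i∈ with ∈-++⁻ (dom x) i∈
    ... | inj₁ i∈x    = inj₁ i∈x
    ... | inj₂ i∈leastInClass = inj₂ (proj₁ (∈-filter⁻ ∉x? i∈leastInClass))

    ∈-dom-mul⁺ : ∀ {i} → i ∈ dom x ⊎ i ∈ dom y → i ∈ dom (mul x y)
    ∈-dom-mul⁺ (inj₁ i∈x) = ∈-++⁺ˡ i∈x
    ∈-dom-mul⁺ {i} (inj₂ i∈y) with i ∈? dom x
    ... | yes i∈x = ∈-++⁺ˡ i∈x
    ... | no  i∉x = ∈-++⁺ʳ (dom x) (∈-filter⁺ ∉x? i∈y i∉x)

    unique-dom-mul : Unique (dom x) → Unique (dom y) → Unique (dom (mul x y))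
    unique-dom-mul x! y! = ++⁺ x! (filter⁺ ∉x? y!)
      λ (i∈x , i∈leastInClass) → proj₂ (∈-filter⁻ ∉x? {xs = dom y} i∈leastInClass) i∈x

    length-dom-mul : length (dom (mul x y)) ≤ length (dom x) + length (dom y)
    length-dom-mul = subst (_≤ length (dom x) + length (dom y)) (sym (length-++ (dom x)))
      (+-monoʳ-≤ (length (dom x)) (length-filter ∉x? (dom y)))

    ωext-mul : ∀ i → ωext (mul x y) i ≡ ωext y (ωext x i)
    ωext-mul i with i ∈? dom (mul x y)
    ... | yes _  = refl
    ... | no  i∉ = sym (trans (cong (ωext y) (ωext-∉ x (i∉ ∘ ∈-dom-mul⁺ ∘ inj₁)))
                              (ωext-∉ y (i∉ ∘ ∈-dom-mul⁺ ∘ inj₂)))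

    Permutes-mul : Permutes (ωext x) (dom x) → Permutes (ωext y) (dom y) →
                   Permutes (ωext (mul x y)) (dom (mul x y))
    Permutes-mul px py = record
      { injective = λ {a} {b} eq → Permutes.injective px (Permutes.injective py
          (trans (sym (ωext-mul a)) (trans eq (ωext-mul b))))
      ; unique    = unique-dom-mul (Permutes.unique px) (Permutes.unique py)
      ; closed    = λ {i} i∈ → subst (_∈ dom (mul x y)) (sym (ωext-mul i))
          (∈-dom-mul⁺ (swap (ωext-closed-∪ y py (swap (ωext-closed-∪ x px (∈-dom-mul⁻ i∈))))))
      }

proposition5p2 : (G : Group 0ℓ 0ℓ) → IsFiniteGroup G → (C : ConjClasses G) →
    (Λ Δ Γ : Family C) →
    (x y : GPartialPerm G) → Valid x → Valid y →
    HasType C x Λ → HasType C y Δ → HasType C (mul x y) Γ →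
    famSize C Γ ≤ famSize C Λ + famSize C Δ
proposition5p2 G _ C Λ Δ Γ x y valid-x valid-y type-x type-y type-xy = begin
  famSize C Γ                      ≡⟨ famSize≡length-dom C (mul x y) Γ pxy type-xy ⟩
  length (dom (mul x y))           ≤⟨ length-dom-mul x y ⟩
  length (dom x) + length (dom y)  ≡⟨ cong₂ _+_ (famSize≡length-dom C x Λ px type-x)
                                                (famSize≡length-dom C y Δ py type-y) ⟨
  famSize C Λ + famSize C Δ        ∎
  where
  open ≤-Reasoning
  px = Valid⇒Permutes valid-x
  py = Valid⇒Permutes valid-y
  pxy = Permutes-mul x y px py
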